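{- Let $r\ge2$ and let $\lambda=(\lambda_1,\dots,\lambda_s)$ be a partition having exactly $r-1$ non-empty successive horizontal Durfee rectangles and no squares, i.e. their heights $d'_1,\dots,d'_{r-1}$ satisfy $d'_j\geq1$ for all $j$ and $d'_1+\dots+d'_{r-1}=s$. Let $b'_1,b'_2,\dots$ be the heights of its successive bottom rectangles, and set $h^B_j=b'_1+\dots+b'_j$, $h^D_j=d'_{r-1}+d'_{r-2}+\dots+d'_{r-j}$ for $1\le j\le r-1$, and $h^D_r=+\infty$. Then for all $1\leq j\leq r-1$, $$h^D_j\leq h^B_j<h^D_{j+1},$$ and $h^D_j=h^B_j$ holds if and only if, for every $k\in\{r-j,\dots,r-1\}$, the partition $\mu_k$ has strictly fewer than $d'_k$ parts.
   Context: A partition is a non-increasing finite sequence of positive integers; row $m$ of the Young diagram (from the top) has $\lambda_m$ boxes. For a (possibly empty) partition $\mu=(\mu_1,\dots,\mu_t)$ let $\mathrm{rect}(\mu)=\max\{h\ge0: h\le t,\ \mu_h\ge h+1\}$ (height of the horizontal Durfee rectangle, the largest rectangle with $h$ rows and $h+1$ columns in the top-left corner). Successive Durfee rectangles: $\mu^{(0)}=\lambda$, $d'_j=\mathrm{rect}(\mu^{(j-1)})$, and $\mu^{(j)}$ is $\mu^{(j-1)}$ with its first $d'_j$ parts deleted; the $j$-th Durfee rectangle occupies rows $d'_1+\dots+d'_{j-1}+1,\dots,d'_1+\dots+d'_j$ and columns $1,\dots,d'_j+1$. The partition $\mu_k$ to the right of the $k$-th Durfee rectangle consists of the positive numbers $\lambda_m-(d'_k+1)$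 for $m$ ranging over the rows of the $k$-th Durfee rectangle. Successive bottom rectangles: $\nu^{(0)}=\lambda$; for $j\ge1$, if $\nu^{(j-1)}=(\nu_1,\dots,\nu_t)$ is nonempty then $b'_j=\nu_t-1$ (the bottom rectangle has width $\nu_t$ and height $\nu_t-1$) and $\nu^{(j)}$ is obtained by deleting the last $\min(\nu_t-1,t)$ parts; if $\nu^{(j-1)}$ is empty then $b'_j=0$ and $\nu^{(j)}$ is empty. -}

module Defs where

open import Data.Nat using (ℕ; zero; suc; _+_; _∸_; _≤_; _<_; _⊔_; _⊓_; _≤ᵇ_)
open import Data.Bool using (Bool; true; false; if_then_else_; _∨_)
open import Data.List using (List; []; _∷_; length; map; foldr; drop; take; filter; upTo)
open import Data.List.Relation.Unary.All using (All)
open import Data.List.Relation.Unary.Linked using (Linked)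
open import Data.Nat using (_≥_)
open import Data.Product using (_×_)
open import Relation.Nullary.Decidable using (does)
open import Data.Nat using (_<?_)

IsPartition : List ℕ → Set
IsPartition λ′ = Linked _≥_ λ′ × All (0 <_) λ′

-- 1-indexed entry of a list (0 outside the range).
nth : ℕ → List ℕ → ℕ
nth _ [] = 0
nth zero (_ ∷ _) = 0
nth (suc zero) (x ∷ _) = x
nth (suc (suc h)) (_ ∷ xs) = nth (suc h) xs

maxList : List ℕ → ℕ
maxList = foldr _⊔_ 0

-- rect(μ) = max { h ≥ 0 : h ≤ t, μ_h ≥ h+1 }  (h = 0 always qualifies)
rect : List ℕ → ℕ
rect μ = maxList (map (λ h → if qualifies h then h else 0) (upTo (suc (length μ))))
  where
  qualifies : ℕ → Bool
  qualifies zero = true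
  qualifies (suc h) = suc (suc h) ≤ᵇ nth (suc h) μ

-- μ^(j): λ with the first j Durfee rectangles' rows removed
durfeeRest : List ℕ → ℕ → List ℕ
durfeeRest λ′ zero = λ′
durfeeRest λ′ (suc j) = drop (rect (durfeeRest λ′ j)) (durfeeRest λ′ j)

-- d'_j (1-indexed; only meaningful for j ≥ 1): d'_j = rect(μ^(j-1))
d′ : List ℕ → ℕ → ℕ
d′ λ′ j = rect (durfeeRest λ′ (j ∸ 1))

sumD : List ℕ → ℕ → ℕ
sumD λ′ zero = 0
sumD λ′ (suc n) = sumD λ′ n + d′ λ′ (suc n)

-- μ_k: the positive numbers λ_m − (d'_k + 1), m over the rows of the k-th Durfee rectangle
muRight : List ℕ → ℕ → List ℕ
muRight λ′ k =
  filter (λ x → 0 <? x)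
    (map (λ x → x ∸ suc (d′ λ′ k)) (take (d′ λ′ k) (durfeeRest λ′ (k ∸ 1))))

lastPart : List ℕ → ℕ
lastPart [] = 0
lastPart (x ∷ []) = x
lastPart (_ ∷ y ∷ ys) = lastPart (y ∷ ys)

-- ν^(j): successive bottom rectangles removed
bottomRest : List ℕ → ℕ → List ℕ
bottomRest λ′ zero = λ′
bottomRest λ′ (suc j) with bottomRest λ′ j
... | [] = []
... | ν@(_ ∷ _) = take (length ν ∸ ((lastPart ν ∸ 1) ⊓ length ν)) ν

-- b'_j (1-indexed): ν_t − 1 for ν^(j-1) = (ν_1..ν_t) nonempty, 0 if empty
b′ : List ℕ → ℕ → ℕ
b′ λ′ j with bottomRest λ′ (j ∸ 1)
... | [] = 0
... | ν@(_ ∷ _) = lastPart ν ∸ 1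

hB : List ℕ → ℕ → ℕ
hB λ′ zero = 0
hB λ′ (suc j) = hB λ′ j + b′ λ′ (suc j)

-- h^D_j = d'_{r-1} + d'_{r-2} + ... + d'_{r-j}  (finite j; h^D_r = ∞ handled in the statement)
hD : List ℕ → ℕ → ℕ → ℕ
hD λ′ r zero = 0
hD λ′ r (suc j) = hD λ′ r j + d′ λ′ (r ∸ suc j)

-- The bottom rectangles are peeled off from the bottom of λ in step with the Durfee rectangles,
-- read from the last one upwards.  Inductively, the last row t = s − h^B_j of ν^(j) lies in the
-- (r−1−j)-th Durfee rectangle, i.e. h^D_j ≤ h^B_j < h^D_{j+1}.  Every row of a Durfee rectangle of
-- height d has length at least d+1, and the row just below one of height d has length at most d+1
-- (otherwise the rectangle would not be maximal).  Hence the next bottom height b′_{j+1} = λ_t − 1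
-- satisfies d′_{r−1−j} ≤ b′_{j+1} ≤ d′_{r−2−j}, which carries the inequalities to j+1.  Equality
-- h^D_{j+1} = h^B_{j+1} needs both h^D_j = h^B_j (so t is the last row of the rectangle) and
-- λ_t = d′_{r−1−j} + 1; since the rows of the rectangle decrease, the latter says exactly that one
-- of them does not stick out past column d′+1, i.e. μ_{r−1−j} has fewer than d′_{r−1−j} parts.
module Submission where

open import Data.Bool using (Bool; true; false; if_then_else_; T)
open import Data.List using (List; []; _∷_; length; map; filter; take; drop; applyUpTo)
open import Data.List.Membership.Propositional using (_∈_)
open import Data.List.Membership.Propositional.Properties using (∈-applyUpTo⁺)
open import Data.List.Properties
  using ( drop-drop; length-drop; length-take; take-take; take-all
        ; length-filter; length-map; filter-accept; filter-reject)
open import Data.List.Relation.Unary.Any using (here; there)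
open import Data.List.Relation.Unary.Linked using (Linked; _∷_)
import Data.List.Relation.Unary.Linked as Linked
open import Data.Nat
open import Data.Nat.Properties
open import Data.Product using (∃; _×_; _,_; proj₁; proj₂)
open import Data.Sum using (inj₁; inj₂)
open import Data.Unit using (tt)
open import Data.Empty using (⊥-elim)
open import Function.Bundles using (_⇔_; mk⇔; Equivalence)
open import Relation.Binary.PropositionalEquality
open import Relation.Nullary using (yes; no; contradiction)

open import Defs

nth-∷ : ∀ {m} x (xs : List ℕ) → 1 ≤ m → nth (suc m) (x ∷ xs) ≡ nth m xs
nth-∷ {suc m} x xs _ = refl

nth-drop : ∀ a {p} (xs : List ℕ) → 1 ≤ p → nth (a + p) xs ≡ nth p (drop a xs)
nth-drop zero xs _ = refl
nth-drop (suc a) [] _ = refl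
nth-drop (suc a) {p} (x ∷ xs) 1≤p =
  trans (nth-∷ x xs (≤-trans 1≤p (m≤n+m p a))) (nth-drop a xs 1≤p)

nth≤head : ∀ {x xs} → Linked _≥_ (x ∷ xs) → ∀ q → nth q (x ∷ xs) ≤ x
nth≤head _ zero = z≤n
nth≤head _ (suc zero) = ≤-refl
nth≤head {xs = []} _ (suc (suc q)) = z≤n
nth≤head {xs = y ∷ ys} (x≥y ∷ sorted) (suc (suc q)) = ≤-trans (nth≤head sorted (suc q)) x≥y

nth-antitone : ∀ {xs} → Linked _≥_ xs → ∀ {p q} → 1 ≤ p → p ≤ q → nth q xs ≤ nth p xs
nth-antitone {[]} _ _ _ = z≤n
nth-antitone {x ∷ xs} sorted {suc zero} {q} _ _ = nth≤head sorted q
nth-antitone {x ∷ xs} sorted {suc (suc p)} {suc (suc q)} _ (s≤s p≤q) =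
  nth-antitone (Linked.tail sorted) (s≤s z≤n) p≤q

Linked-drop : ∀ {A : Set} {R : A → A → Set} n {xs} → Linked R xs → Linked R (drop n xs)
Linked-drop zero l = l
Linked-drop (suc n) {[]} l = l
Linked-drop (suc n) {x ∷ xs} l = Linked-drop n (Linked.tail l)

-- rect μ is definitionally selectMax (λ h → μ_h ≥ h+1) (length μ), so the lemmas below apply to it
-- by unification, without naming that test (it is local to rect).
selectMax : (ℕ → Bool) → ℕ → ℕ
selectMax q n = maxList (map (λ h → if q h then h else 0) (applyUpTo suc n))

maxList-upper : ∀ (g : ℕ → ℕ) {xs x} → x ∈ xs → g x ≤ maxList (map g xs)
maxList-upper g {y ∷ ys} (here refl) = m≤m⊔n (g y) _
maxList-upper g {y ∷ ys} (there x∈ys) = ≤-trans (maxList-upper g x∈ys) (m≤n⊔m (g y) _)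

maxList-attained : ∀ (g : ℕ → ℕ) xs → 1 ≤ maxList (map g xs) → ∃ λ x → g x ≡ maxList (map g xs)
maxList-attained g (y ∷ ys) pos with ⊔-sel (g y) (maxList (map g ys))
... | inj₁ e = y , sym e
... | inj₂ e with maxList-attained g ys (subst (1 ≤_) e pos)
...   | x , gx≡ = x , trans gx≡ (sym e)

if-positive : ∀ b {x m} → (if b then x else 0) ≡ m → 1 ≤ m → T b × x ≡ m
if-positive true eq _ = tt , eq
if-positive false refl ()

selectMax-selected : ∀ q n (P : ℕ → Set) → (∀ h → T (q (suc h)) → P (suc h)) →
  1 ≤ selectMax q n → P (selectMax q n)
selectMax-selected q n P sound pos
  with maxList-attained (λ h → if q h then h else 0) (applyUpTo suc n) pos
... | x , gx≡ with if-positive (q x) gx≡ pos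
...   | qx , refl with x
...     | suc h = sound h qx

selectMax-maximal : ∀ q {n h} → h < n → T (q (suc h)) → suc h ≤ selectMax q n
selectMax-maximal q {h = h} h<n qh =
  ≤-trans (selected (q (suc h)) qh)
          (maxList-upper (λ h → if q h then h else 0) (∈-applyUpTo⁺ suc h<n))
  where
  selected : ∀ b → T b → suc h ≤ (if b then suc h else 0)
  selected true _ = ≤-refl

rect-wide : ∀ μ → 1 ≤ rect μ → suc (rect μ) ≤ nth (rect μ) μ
rect-wide μ = selectMax-selected _ (length μ) (λ m → suc m ≤ nth m μ) (λ h → ≤ᵇ⇒≤ _ _)

rect-narrow : ∀ μ → suc (rect μ) ≤ length μ → nth (suc (rect μ)) μ ≤ suc (rect μ)
rect-narrow μ len with suc (suc (rect μ)) ≤? nth (suc (rect μ)) μ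
... | no ¬wide = ≮⇒≥ ¬wide
... | yes wide = ⊥-elim (1+n≰n {rect μ} (selectMax-maximal _ len (≤⇒≤ᵇ wide)))

partsBeyond : ℕ → List ℕ → List ℕ
partsBeyond c xs = filter (λ x → 0 <? x) (map (λ x → x ∸ c) xs)

length-partsBeyond≤ : ∀ c xs → length (partsBeyond c xs) ≤ length xs
length-partsBeyond≤ c xs = ≤-trans (length-filter (λ x → 0 <? x) (map (λ x → x ∸ c) xs))
                                   (≤-reflexive (length-map (λ x → x ∸ c) xs))

length-partsBeyond-accept : ∀ {c x} xs → c < x →
  length (partsBeyond c (x ∷ xs)) ≡ suc (length (partsBeyond c xs))
length-partsBeyond-accept xs c<x = cong length (filter-accept (λ x → 0 <? x) (m<n⇒0<n∸m c<x))

length-partsBeyond-reject : ∀ {c x} xs → x ≤ c →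
  length (partsBeyond c (x ∷ xs)) ≡ length (partsBeyond c xs)
length-partsBeyond-reject xs x≤c =
  cong length (filter-reject (λ x → 0 <? x) (<-irrefl (sym (m≤n⇒m∸n≡0 x≤c))))

partsBeyond-short⇔ : ∀ {c d μ} → Linked _≥_ μ → 1 ≤ d → c ≤ nth d μ →
  length (partsBeyond c (take d μ)) < d ⇔ nth d μ ≡ c
partsBeyond-short⇔ {d = suc d} {[]} _ _ c≤0 = mk⇔ (λ _ → sym (n≤0⇒n≡0 c≤0)) (λ _ → s≤s z≤n)
partsBeyond-short⇔ {c} {suc zero} {x ∷ μ} _ _ c≤x with c <? x
... | yes c<x rewrite length-partsBeyond-accept [] c<x =
  mk⇔ (λ { (s≤s ()) }) (λ x≡c → contradiction (sym x≡c) (<⇒≢ c<x))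
... | no c≮x rewrite length-partsBeyond-reject [] (≮⇒≥ c≮x) =
  mk⇔ (λ _ → ≤-antisym (≮⇒≥ c≮x) c≤x) (λ _ → s≤s z≤n)
partsBeyond-short⇔ {c} {suc (suc d)} {x ∷ μ} sorted _ c≤nth with c <? x
... | yes c<x rewrite length-partsBeyond-accept (take (suc d) μ) c<x =
  mk⇔ (λ lt → Equivalence.to tail⇔ (s≤s⁻¹ lt)) (λ nth≡c → s≤s (Equivalence.from tail⇔ nth≡c))
  where tail⇔ = partsBeyond-short⇔ (Linked.tail sorted) (s≤s z≤n) c≤nth
... | no c≮x rewrite length-partsBeyond-reject (take (suc d) μ) (≮⇒≥ c≮x) =
  mk⇔ (λ _ → ≤-antisym (≤-trans (nth≤head sorted (suc (suc d))) (≮⇒≥ c≮x)) c≤nth)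
      (λ _ → s≤s (≤-trans (length-partsBeyond≤ c (take (suc d) μ)) (length-take≤ (suc d) μ)))
  where
  length-take≤ : ∀ n (xs : List ℕ) → length (take n xs) ≤ n
  length-take≤ n xs = ≤-trans (≤-reflexive (length-take n xs)) (m⊓n≤m n (length xs))

durfeeRest≡drop : ∀ λ′ k → durfeeRest λ′ k ≡ drop (sumD λ′ k) λ′
durfeeRest≡drop λ′ zero = refl
durfeeRest≡drop λ′ (suc k) rewrite durfeeRest≡drop λ′ k = drop-drop (sumD λ′ k) _ λ′

nth-sumD : ∀ λ′ k {p} → 1 ≤ p → nth (sumD λ′ k + p) λ′ ≡ nth p (durfeeRest λ′ k)
nth-sumD λ′ k 1≤p = trans (nth-drop (sumD λ′ k) λ′ 1≤p) (cong (nth _) (sym (durfeeRest≡drop λ′ k)))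

Linked-durfeeRest : ∀ {λ′} k → Linked _≥_ λ′ → Linked _≥_ (durfeeRest λ′ k)
Linked-durfeeRest {λ′} k sorted =
  subst (Linked _≥_) (sym (durfeeRest≡drop λ′ k)) (Linked-drop (sumD λ′ k) sorted)

rect-last-row : ∀ λ′ k → 1 ≤ d′ λ′ (suc k) → suc (d′ λ′ (suc k)) ≤ nth (sumD λ′ (suc k)) λ′
rect-last-row λ′ k pos =
  subst (suc (d′ λ′ (suc k)) ≤_) (sym (nth-sumD λ′ k pos)) (rect-wide (durfeeRest λ′ k) pos)

row-below-rect : ∀ λ′ k → sumD λ′ (suc k) < length λ′ →
  nth (suc (sumD λ′ (suc k))) λ′ ≤ suc (d′ λ′ (suc k))
row-below-rect λ′ k below =
  subst (_≤ suc d) (trans (sym (nth-sumD λ′ k (s≤s z≤n))) (cong (λ i → nth i λ′) (+-suc X d)))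
    (rect-narrow (durfeeRest λ′ k) room)
  where
  X = sumD λ′ k
  d = d′ λ′ (suc k)
  room : suc d ≤ length (durfeeRest λ′ k)
  room = subst (suc d ≤_) (sym (trans (cong length (durfeeRest≡drop λ′ k)) (length-drop X λ′)))
           (m+n≤o⇒m≤o∸n (suc d) (subst (_≤ length λ′) (cong suc (+-comm X d)) below))

rows-of-rect-wide : ∀ {λ′} k {t} → Linked _≥_ λ′ → 1 ≤ d′ λ′ (suc k) → 1 ≤ t → t ≤ sumD λ′ (suc k) →
  suc (d′ λ′ (suc k)) ≤ nth t λ′
rows-of-rect-wide {λ′} k sorted pos 1≤t t≤S =
  ≤-trans (rect-last-row λ′ k pos) (nth-antitone sorted 1≤t t≤S)

rows-below-rect-narrow : ∀ {λ′} k {t} → Linked _≥_ λ′ → 1 ≤ k → sumD λ′ k < t → t ≤ length λ′ →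
  nth t λ′ ≤ suc (d′ λ′ k)
rows-below-rect-narrow {λ′} (suc k) sorted _ S<t t≤s =
  ≤-trans (nth-antitone sorted (s≤s z≤n) S<t) (row-below-rect λ′ k (<-≤-trans S<t t≤s))

muRight-short⇔ : ∀ {λ′} k → Linked _≥_ λ′ → 1 ≤ d′ λ′ (suc k) →
  length (muRight λ′ (suc k)) < d′ λ′ (suc k) ⇔ nth (sumD λ′ (suc k)) λ′ ≡ suc (d′ λ′ (suc k))
muRight-short⇔ {λ′} k sorted pos =
  mk⇔ (λ short → trans last-row (Equivalence.to short⇔ short))
      (λ filled → Equivalence.from short⇔ (trans (sym last-row) filled))
  where
  last-row = nth-sumD λ′ k pos
  short⇔ = partsBeyond-short⇔ (Linked-durfeeRest k sorted) pos (rect-wide (durfeeRest λ′ k) pos)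

lastPart-take : ∀ {t} (xs : List ℕ) → 1 ≤ t → t ≤ length xs → lastPart (take t xs) ≡ nth t xs
lastPart-take {suc zero} (x ∷ xs) _ _ = refl
lastPart-take {suc (suc t)} (x ∷ []) _ (s≤s ())
lastPart-take {suc (suc t)} (x ∷ y ∷ ys) _ (s≤s le) = lastPart-take (y ∷ ys) (s≤s z≤n) le

b′-from-take : ∀ λ′ j {t} → bottomRest λ′ j ≡ take t λ′ → 1 ≤ t → t ≤ length λ′ →
  b′ λ′ (suc j) ≡ nth t λ′ ∸ 1
b′-from-take λ′@(_ ∷ _) j {suc _} eq 1≤t t≤s with bottomRest λ′ j | eq
... | _ | refl = cong (_∸ 1) (lastPart-take λ′ 1≤t t≤s)

bottomRest-from-take : ∀ λ′ j {t} → bottomRest λ′ j ≡ take t λ′ → 1 ≤ t → t ≤ length λ′ →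
  nth t λ′ ∸ 1 ≤ t → bottomRest λ′ (suc j) ≡ take (t ∸ (nth t λ′ ∸ 1)) λ′
bottomRest-from-take λ′@(_ ∷ _) j {t@(suc _)} eq 1≤t t≤s fits with bottomRest λ′ j | eq
... | _ | refl = begin
  take (length ν ∸ ((lastPart ν ∸ 1) ⊓ length ν)) ν
    ≡⟨ cong₂ (λ ℓ b → take (ℓ ∸ (b ⊓ ℓ)) ν) length-ν (cong (_∸ 1) (lastPart-take λ′ 1≤t t≤s)) ⟩
  take (t ∸ (b ⊓ t)) (take t λ′)
    ≡⟨ cong (λ m → take (t ∸ m) ν) (m≤n⇒m⊓n≡m fits) ⟩
  take (t ∸ b) (take t λ′)
    ≡⟨ take-take (t ∸ b) t λ′ ⟩
  take ((t ∸ b) ⊓ t) λ′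
    ≡⟨ cong (λ m → take m λ′) (m≤n⇒m⊓n≡m (m∸n≤m t b)) ⟩
  take (t ∸ b) λ′ ∎
  where
  open ≡-Reasoning
  ν = take t λ′
  b = nth t λ′ ∸ 1
  length-ν : length ν ≡ t
  length-ν = trans (length-take t λ′) (m≤n⇒m⊓n≡m t≤s)

d′≤sumD : ∀ λ′ {k} → 1 ≤ k → d′ λ′ k ≤ sumD λ′ k
d′≤sumD λ′ {suc k} _ = m≤n+m (d′ λ′ (suc k)) (sumD λ′ k)

n<m⇒m∸n≡1+[m∸1+n] : ∀ {m n} → n < m → m ∸ n ≡ suc (m ∸ suc n)
n<m⇒m∸n≡1+[m∸1+n] {suc m} (s≤s n≤m) = +-∸-assoc 1 n≤m

sumD-split : ∀ λ′ n j → j ≤ n → sumD λ′ (n ∸ j) + hD λ′ (suc n) j ≡ sumD λ′ n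
sumD-split λ′ n zero _ = +-identityʳ (sumD λ′ n)
sumD-split λ′ n (suc j) j<n = begin
  sumD λ′ k + (H j + d′ λ′ (n ∸ j))  ≡⟨ cong (λ i → sumD λ′ k + (H j + d′ λ′ i)) e ⟩
  sumD λ′ k + (H j + d′ λ′ (suc k))  ≡⟨ cong (sumD λ′ k +_) (+-comm (H j) _) ⟩
  sumD λ′ k + (d′ λ′ (suc k) + H j)  ≡⟨ sym (+-assoc (sumD λ′ k) _ (H j)) ⟩
  sumD λ′ (suc k) + H j              ≡⟨ cong (λ i → sumD λ′ i + H j) (sym e) ⟩
  sumD λ′ (n ∸ j) + H j              ≡⟨ sumD-split λ′ n j (<⇒≤ j<n) ⟩
  sumD λ′ n                          ∎
  where
  open ≡-Reasoning
  H = hD λ′ (suc n)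
  k = n ∸ suc j
  e : n ∸ j ≡ suc k
  e = n<m⇒m∸n≡1+[m∸1+n] j<n

∸-in-block : ∀ X D H {B} → H ≤ B → B < H + D → X < X + D + H ∸ B × X + D + H ∸ B ≤ X + D
∸-in-block X D H {B} H≤B B<H+D = m+n≤o⇒m≤o∸n (suc X) below , above
  where
  open ≤-Reasoning
  below : suc X + B ≤ X + D + H
  below = begin
    suc X + B  ≡⟨ sym (+-suc X B) ⟩
    X + suc B  ≤⟨ +-monoʳ-≤ X B<H+D ⟩
    X + (H + D) ≡⟨ cong (X +_) (+-comm H D) ⟩
    X + (D + H) ≡⟨ sym (+-assoc X D H) ⟩
    X + D + H  ∎
  above : X + D + H ∸ B ≤ X + D
  above = ≤-trans (∸-monoʳ-≤ (X + D + H) H≤B) (≤-reflexive (m+n∸n≡m (X + D) H))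

+-≡-split⇔ : ∀ {a b c d} → a ≤ b → c ≤ d → a + c ≡ b + d ⇔ (a ≡ b × c ≡ d)
+-≡-split⇔ {a} {b} {c} {d} a≤b c≤d = mk⇔ split (λ (a≡b , c≡d) → cong₂ _+_ a≡b c≡d)
  where
  split : a + c ≡ b + d → a ≡ b × c ≡ d
  split eq with m≤n⇒m<n∨m≡n a≤b
  ... | inj₁ a<b = contradiction eq (<⇒≢ (+-mono-<-≤ a<b c≤d))
  ... | inj₂ refl = refl , +-cancelˡ-≡ a c d eq

interval-split : ∀ {P : ℕ → Set} {a n} → a ≤ n →
  (∀ i → a ≤ i → i ≤ n → P i) ⇔ ((∀ i → suc a ≤ i → i ≤ n → P i) × P a)
interval-split {P} {a} {n} a≤n =
  mk⇔ (λ all → (λ i a<i i≤n → all i (<⇒≤ a<i) i≤n) , all a ≤-refl a≤n)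
      (λ (above , at) → combine above at)
  where
  combine : (∀ i → suc a ≤ i → i ≤ n → P i) → P a → ∀ i → a ≤ i → i ≤ n → P i
  combine above at i a≤i i≤n with m≤n⇒m<n∨m≡n a≤i
  ... | inj₁ a<i = above i a<i i≤n
  ... | inj₂ refl = at

-- n = r − 1 is the number of Durfee rectangles.
module BottomRectangles (n : ℕ) (λ′ : List ℕ) (sorted : Linked _≥_ λ′)
  (d′-positive : ∀ k → 1 ≤ k → k ≤ n → 1 ≤ d′ λ′ k)
  (sumD-length : sumD λ′ n ≡ length λ′) where

  H : ℕ → ℕ
  H = hD λ′ (suc n)

  Short : ℕ → Set
  Short k = length (muRight λ′ k) < d′ λ′ k

  ShortFrom : ℕ → Set
  ShortFrom a = ∀ k → a ≤ k → k ≤ n → Short k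

  record Stage (j : ℕ) : Set where
    field
      hD≤hB : H j ≤ hB λ′ j
      hB<hD : j < n → hB λ′ j < H (suc j)
      bottomRest≡take : j < n → bottomRest λ′ j ≡ take (length λ′ ∸ hB λ′ j) λ′
      hD≡hB⇔short : H j ≡ hB λ′ j ⇔ ShortFrom (suc (n ∸ j))

  stage-zero : Stage 0
  stage-zero = record
    { hD≤hB = z≤n
    ; hB<hD = λ 0<n → d′-positive n 0<n ≤-refl
    ; bottomRest≡take = λ _ → sym (take-all (length λ′) λ′ ≤-refl)
    ; hD≡hB⇔short = mk⇔ (λ _ k n<k k≤n → contradiction k≤n (<⇒≱ n<k)) (λ _ → refl)
    }

  -- Row t, the last row of ν^(j), lies in the Durfee rectangle number suc k = n ∸ j.
  module Step {j} (j<n : j < n) (previous : Stage j) where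
    open Stage previous

    k = n ∸ suc j
    D = d′ λ′ (suc k)
    B = hB λ′ j
    t = length λ′ ∸ B
    v = nth t λ′

    k-suc : n ∸ j ≡ suc k
    k-suc = n<m⇒m∸n≡1+[m∸1+n] j<n

    H-suc : H (suc j) ≡ H j + D
    H-suc = cong (λ i → H j + d′ λ′ i) k-suc

    size : sumD λ′ (suc k) + H j ≡ length λ′
    size = trans (cong (λ i → sumD λ′ i + H j) (sym k-suc))
                 (trans (sumD-split λ′ n j (<⇒≤ j<n)) sumD-length)

    D-positive : 1 ≤ D
    D-positive = d′-positive (suc k) (s≤s z≤n) (subst (_≤ n) k-suc (m∸n≤m n j))

    t-in-block : sumD λ′ k < t × t ≤ sumD λ′ (suc k)
    t-in-block = subst (λ s → sumD λ′ k < s ∸ B × s ∸ B ≤ sumD λ′ (suc k)) size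
                   (∸-in-block (sumD λ′ k) D (H j) hD≤hB (subst (B <_) H-suc (hB<hD j<n)))

    t-positive : 1 ≤ t
    t-positive = ≤-trans (s≤s z≤n) (proj₁ t-in-block)

    v-wide : suc D ≤ v
    v-wide = rows-of-rect-wide k sorted D-positive t-positive (proj₂ t-in-block)

    b′≡v∸1 : b′ λ′ (suc j) ≡ v ∸ 1
    b′≡v∸1 = b′-from-take λ′ j (bottomRest≡take j<n) t-positive (m∸n≤m (length λ′) B)

    D≤b′ : D ≤ b′ λ′ (suc j)
    D≤b′ = subst (D ≤_) (sym b′≡v∸1) (∸-monoˡ-≤ 1 v-wide)

    b′≤d′ : suc j < n → b′ λ′ (suc j) ≤ d′ λ′ k
    b′≤d′ sj<n = subst (_≤ d′ λ′ k) (sym b′≡v∸1) (∸-monoˡ-≤ 1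
      (rows-below-rect-narrow k sorted (m<n⇒0<n∸m sj<n) (proj₁ t-in-block) (m∸n≤m (length λ′) B)))

    bottom-fits : suc j < n → v ∸ 1 ≤ t
    bottom-fits sj<n = ≤-trans (subst (_≤ d′ λ′ k) b′≡v∸1 (b′≤d′ sj<n))
      (≤-trans (d′≤sumD λ′ (m<n⇒0<n∸m sj<n)) (<⇒≤ (proj₁ t-in-block)))

    t-at-last-row : H j ≡ B → t ≡ sumD λ′ (suc k)
    t-at-last-row H≡B = trans (cong (length λ′ ∸_) (sym H≡B))
      (trans (cong (_∸ H j) (sym size)) (m+n∸n≡m (sumD λ′ (suc k)) (H j)))

    last-row⇔ : H j ≡ B → D ≡ b′ λ′ (suc j) ⇔ Short (suc k)
    last-row⇔ H≡B = mk⇔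
      (λ D≡b′ → Equivalence.from short⇔ (trans (cong (λ i → nth i λ′) (sym (t-at-last-row H≡B)))
                  (trans (sym (m+[n∸m]≡n (≤-trans (s≤s z≤n) v-wide)))
                         (cong suc (sym (trans D≡b′ b′≡v∸1))))))
      (λ short → trans (cong (_∸ 1) (sym (trans (cong (λ i → nth i λ′) (t-at-last-row H≡B))
                  (Equivalence.to short⇔ short)))) (sym b′≡v∸1))
      where short⇔ = muRight-short⇔ k sorted D-positive

    hD≡hB⇔short-suc : H (suc j) ≡ hB λ′ (suc j) ⇔ ShortFrom (suc k)
    hD≡hB⇔short-suc = mk⇔
      (λ eq → let (H≡B , D≡b′) = Equivalence.to split (trans (sym H-suc) eq) in
        Equivalence.from shortFrom-split
          (Equivalence.to shortFrom-above H≡B , Equivalence.to (last-row⇔ H≡B) D≡b′))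
      (λ short → let (above , at-k) = Equivalence.to shortFrom-split short
                     H≡B = Equivalence.from shortFrom-above above in
        trans H-suc (Equivalence.from split (H≡B , Equivalence.from (last-row⇔ H≡B) at-k)))
      where
      split = +-≡-split⇔ hD≤hB D≤b′
      shortFrom-above = subst (λ a → H j ≡ B ⇔ ShortFrom (suc a)) k-suc hD≡hB⇔short
      shortFrom-split = interval-split {Short} (subst (_≤ n) k-suc (m∸n≤m n j))

  stage-suc : ∀ {j} → j < n → Stage j → Stage (suc j)
  stage-suc {j} j<n previous = record
    { hD≤hB = subst (_≤ B + b′ λ′ (suc j)) (sym H-suc) (+-mono-≤ hD≤hB D≤b′)
    ; hB<hD = λ sj<n → subst (λ h → B + b′ λ′ (suc j) < h + d′ λ′ k) (sym H-suc)
                         (+-mono-<-≤ (subst (B <_) H-suc (hB<hD j<n)) (b′≤d′ sj<n))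
    ; bottomRest≡take = λ sj<n →
        trans (bottomRest-from-take λ′ j (bottomRest≡take j<n) t-positive (m∸n≤m (length λ′) B)
                                    (bottom-fits sj<n))
              (cong (λ m → take m λ′) (trans (∸-+-assoc (length λ′) B (v ∸ 1))
                                             (cong (λ b → length λ′ ∸ (B + b)) (sym b′≡v∸1))))
    ; hD≡hB⇔short = hD≡hB⇔short-suc
    }
    where
    open Stage previous
    open Step j<n previous

  stage : ∀ j → j ≤ n → Stage j
  stage zero _ = stage-zero
  stage (suc j) j<n = stage-suc j<n (stage j (<⇒≤ j<n))

proposition3p4 : (r : ℕ) → 2 ≤ r → (λ′ : List ℕ) → IsPartition λ′ →
    (∀ j → 1 ≤ j → j ≤ r ∸ 1 → 1 ≤ d′ λ′ j) →
    sumD λ′ (r ∸ 1) ≡ length λ′ →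
    (j : ℕ) → 1 ≤ j → j ≤ r ∸ 1 →
      (hD λ′ r j ≤ hB λ′ j
        × (suc j ≤ r ∸ 1 → hB λ′ j < hD λ′ r (suc j)))
      × ((hD λ′ r j ≡ hB λ′ j)
          ⇔ (∀ k → r ∸ j ≤ k → k ≤ r ∸ 1 → length (muRight λ′ k) < d′ λ′ k))
proposition3p4 (suc (suc m)) _ λ′ (sorted , _) d′-positive sumD-length j _ j≤n =
  (hD≤hB , hB<hD) , subst (λ a → H j ≡ hB λ′ j ⇔ ShortFrom a) (sym (+-∸-assoc 1 j≤n)) hD≡hB⇔short
  where
  open BottomRectangles (suc m) λ′ sorted d′-positive sumD-length
  open Stage (stage j j≤n)
proposition3p4 (suc zero) (s≤s ())
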